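{- Let $s\ge1$ and $k\ge1$ be integers, and let $n=N_s[k]\doteq F_{s(2k+1)}/F_s$, where $F_j=2^j+1$. Then $n$ is an integer and \[ 2^{s(2k+1)}\equiv 2^{s}\pmod{n-1},\qquad 2^{s(2k+1)}\equiv n-1\pmod{n}. \] In particular, whenever $2^s<n-1$, we have $(2^{s(2k+1)}\bmod n)-(2^{s(2k+1)}\bmod(n-1))=n-F_s$.
   Context: $x\bmod n$ denotes the least nonnegative residue. $F_j\doteq 2^j+1$. -}

module Defs where

open import Data.Nat using (ℕ; suc; _∸_; _+_; _*_; _^_; _<_; NonZero; >-nonZero)
import Data.Nat.Properties
open import Data.Nat.DivMod using (_/_)
import Data.Integer as ℤ
open import Data.Integer.Divisibility using () renaming (_∣_ to _∣ℤ_)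

-- F j = 2^j + 1  (written 1 + 2^j so that it is definitionally suc (2^j), hence NonZero)
F : ℕ → ℕ
F j = 1 + 2 ^ j

-- N_s[k] = F_{s(2k+1)} / F_s   (ℕ floor division; the theorem asserts exactness)
N : ℕ → ℕ → ℕ
N s k = F (s * (2 * k + 1)) / F s

_≡_[mod_] : ℤ.ℤ → ℤ.ℤ → ℤ.ℤ → Set
a ≡ b [mod m ] = m ∣ℤ (a ℤ.- b)

<⇒nonZero : ∀ {a b} → a < b → NonZero b
<⇒nonZero {a} {suc b} _ = _

<∸1⇒nonZero : ∀ {a n} → a < n ∸ 1 → NonZero n
<∸1⇒nonZero {a} {suc n} _ = _

{-# OPTIONS --safe #-}
module Submission where

-- Write a = 2^s, so that n = (a^(2k+1) + 1)/(a + 1) = 1 + (a - 1)(a + a³ + ⋯ + a^(2k-1)).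
-- All three congruences only use that x = a^(2k+1) satisfies x + 1 = (a + 1)n:
-- then x = a + (a + 1)(n - 1) = (n - 1) + a n, and both remainders can be read off.

open import Defs
open import Data.Nat using (ℕ; zero; suc; NonZero; _≥_; _<_; _*_; _+_; _∸_; _^_; _%_)
open import Data.Nat.Properties
  using (suc-injective; *-comm; ≤-refl; m≤m+n; m+n∸m≡n; ^-*-assoc; m^n≢0)
open import Data.Nat.DivMod using (_/_; [m+kn]%n≡m%n; m<n⇒m%n≡m; m*n/n≡m)
open import Data.Nat.Divisibility using (_∣_; divides)
open import Data.Nat.Solver using (module +-*-Solver)
open import Data.Integer using (+_; _-_; _⊖_; ∣_∣)
open import Data.Integer.Properties using (m-n≡m⊖n; ⊖-≥; [1+m]⊖[1+n]≡m⊖n)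
open import Data.Product using (_×_; _,_)
open import Relation.Binary.PropositionalEquality
  using (_≡_; refl; sym; trans; cong; cong₂; subst; module ≡-Reasoning)

open +-*-Solver

oddPowerSum : ℕ → ℕ → ℕ
oddPowerSum a zero    = 0
oddPowerSum a (suc k) = oddPowerSum a k + a ^ (2 * k + 1)

cofactor : ℕ → ℕ → ℕ
cofactor a k = 1 + (a ∸ 1) * oddPowerSum a k

suc-a*cofactor≡suc-a^odd : ∀ a k .{{_ : NonZero a}} →
                           suc a * cofactor a k ≡ suc (a ^ (2 * k + 1))
suc-a*cofactor≡suc-a^odd (suc b) zero =
  solve 1 (λ b → (con 2 :+ b) :* (con 1 :+ b :* con 0) := con 1 :+ (con 1 :+ b) :* con 1) refl b
suc-a*cofactor≡suc-a^odd a@(suc b) (suc k) = begin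
    suc a * (1 + b * (S + t))
  ≡⟨ solve 3 (λ b S t → (con 2 :+ b) :* (con 1 :+ b :* (S :+ t))
                      := (con 2 :+ b) :* (con 1 :+ b :* S) :+ (con 2 :+ b) :* b :* t)
           refl b S t ⟩
    suc a * (1 + b * S) + suc a * b * t
  ≡⟨ cong (_+ suc a * b * t) (suc-a*cofactor≡suc-a^odd a k) ⟩
    suc t + suc a * b * t
  ≡⟨ solve 2 (λ b t → con 1 :+ t :+ (con 2 :+ b) :* b :* t
                    := con 1 :+ (con 1 :+ b) :* ((con 1 :+ b) :* t))
           refl b t ⟩
    suc (a * (a * t))
  ≡⟨ cong (λ e → suc (a ^ e)) (solve 1 (λ k → con 2 :+ (con 2 :* k :+ con 1)
                                           := con 2 :* (con 1 :+ k) :+ con 1) refl k) ⟩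
    suc (a ^ (2 * suc k + 1))
  ∎
  where
  open ≡-Reasoning
  S = oddPowerSum a k
  t = a ^ (2 * k + 1)

≡[mod]-intro : ∀ {x} y q m → x ≡ y + q * m → (+ x) ≡ (+ y) [mod (+ m) ]
≡[mod]-intro y q m refl = divides q (begin
    ∣ + (y + q * m) - + y ∣  ≡⟨ cong ∣_∣ (m-n≡m⊖n (y + q * m) y) ⟩
    ∣ (y + q * m) ⊖ y ∣      ≡⟨ cong ∣_∣ (⊖-≥ (m≤m+n y (q * m))) ⟩
    y + q * m ∸ y            ≡⟨ m+n∸m≡n y (q * m) ⟩
    q * m                    ∎)
  where open ≡-Reasoning

%-intro : ∀ {x} r q n .{{_ : NonZero n}} → x ≡ r + q * n → r < n → x % n ≡ r
%-intro r q n refl r<n = trans ([m+kn]%n≡m%n r q n) (m<n⇒m%n≡m r<n)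

PredecessorCongruences : ℕ → ℕ → ℕ → Set
PredecessorCongruences a x n =
  ((+ x) ≡ (+ a) [mod (+ (n ∸ 1)) ])
  × ((+ x) ≡ (+ (n ∸ 1)) [mod (+ n) ])
  × ((h : a < n ∸ 1) →
       (+ (_%_ x n {{<∸1⇒nonZero h}})) - (+ (_%_ x (n ∸ 1) {{<⇒nonZero h}}))
       ≡ (+ n) - (+ (suc a)))

predecessorCongruences : ∀ a m x → suc x ≡ suc a * suc m →
                         PredecessorCongruences a x (suc m)
predecessorCongruences a m x eq =
  ≡[mod]-intro a (suc a) m x≡a+[1+a]m , ≡[mod]-intro m a (suc m) x≡m+a[1+m] , remainders
  where
  x≡m+a[1+m] : x ≡ m + a * suc m
  x≡m+a[1+m] = suc-injective eq

  x≡a+[1+a]m : x ≡ a + suc a * m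
  x≡a+[1+a]m = trans x≡m+a[1+m]
    (solve 2 (λ a m → m :+ a :* (con 1 :+ m) := a :+ (con 1 :+ a) :* m) refl a m)

  remainders : (h : a < m) → + (x % suc m) - + (_%_ x m {{<⇒nonZero h}}) ≡ + suc m - + suc a
  remainders a<m = begin
      + (x % suc m) - + (_%_ x m {{<⇒nonZero a<m}})
    ≡⟨ cong₂ (λ u v → + u - + v) (%-intro m a (suc m) x≡m+a[1+m] ≤-refl)
                                 (%-intro a (suc a) m {{<⇒nonZero a<m}} x≡a+[1+a]m a<m) ⟩
      + m - + a
    ≡⟨ m-n≡m⊖n m a ⟩
      m ⊖ a
    ≡⟨ [1+m]⊖[1+n]≡m⊖n m a ⟨
      suc m ⊖ suc a
    ≡⟨ m-n≡m⊖n (suc m) (suc a) ⟨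
      + suc m - + suc a
    ∎
    where open ≡-Reasoning

proposition7 : (s k : ℕ) → s ≥ 1 → k ≥ 1 →
    let n = N s k in
    let e = s * (2 * k + 1) in
      (F s ∣ F e)
      × ((+ (2 ^ e)) ≡ (+ (2 ^ s)) [mod (+ (n ∸ 1)) ])
      × ((+ (2 ^ e)) ≡ (+ (n ∸ 1)) [mod (+ n) ])
      × ((h : 2 ^ s < n ∸ 1) →
           (+ (_%_ (2 ^ e) n {{<∸1⇒nonZero h}}))
             - (+ (_%_ (2 ^ e) (n ∸ 1) {{<⇒nonZero h}}))
           ≡ (+ n) - (+ (F s)))
proposition7 s k _ _ =
  divides c (trans F[e]≡F[s]*c (*-comm (F s) c)) ,
  subst (PredecessorCongruences a x) (sym N≡c)
        (predecessorCongruences a ((a ∸ 1) * oddPowerSum a k) x F[e]≡F[s]*c)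
  where
  open ≡-Reasoning
  a = 2 ^ s
  x = 2 ^ (s * (2 * k + 1))
  c = cofactor a k

  F[e]≡F[s]*c : suc x ≡ suc a * c
  F[e]≡F[s]*c = begin
    suc x                   ≡⟨ cong suc (^-*-assoc 2 s (2 * k + 1)) ⟨
    suc (a ^ (2 * k + 1))   ≡⟨ suc-a*cofactor≡suc-a^odd a k {{m^n≢0 2 s}} ⟨
    suc a * c               ∎

  N≡c : N s k ≡ c
  N≡c = trans (cong (_/ F s) (trans F[e]≡F[s]*c (*-comm (suc a) c))) (m*n/n≡m c (F s))
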